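{- For a game $G$: if $G$ is of type $\mathcal P$ then $G+G$ is of type $\mathcal P$ or $\mathcal Q$; if $G$ is of type $\mathcal N$ then $G+G$ is of type $\mathcal O$ or $\mathcal Q$; if $G$ is of type $\mathcal O$ then $G+G$ is of type $\mathcal N$ or $\mathcal Q$; if $G$ is of type $\mathcal Q$ then $G+G$ is of type $\mathcal O$ or $\mathcal Q$. Moreover each of these eight possibilities occurs for some game $G$.
   Context: A (finite impartial) game is defined recursively as a finite set of games, its options; $0$ is the game with no options. Three players alternate moves cyclically; a move replaces the current game by one of its options, and the player who makes the last move wins. The disjunctive sum $G+H$ is the game whose options are all $G'+H$ ($G'$ an option of $G$) and all $G+H'$ ($H'$ an option of $H$). Types are defined recursively: $G$ is of type $\mathcal N$ iff it has some option of type $\mathcal P$; of type $\mathcal O$ iff it has at least one option and all its options are of type $\mathcal N$; of type $\mathcal P$ iff all its options are of type $\mathcal O$ (so $0$ is of type $\mathcal P$); of type $\mathcal Q$ otherwise. -}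

module Defs where

open import Data.Nat using (ℕ; _+_)
open import Data.Fin using (Fin; splitAt)
open import Data.Sum using (_⊎_; [_,_]′)
open import Data.Bool using (Bool; true; false; if_then_else_; _∧_; _∨_)
open import Data.List using (List; []; _∷_; tabulate)

-- A finite impartial game: a finite family of options (indexed by Fin n).
-- Duplicates/ordering of options are irrelevant to everything below.
data Game : Set where
  node : (n : ℕ) → (Fin n → Game) → Game

zeroGame : Game
zeroGame = node 0 (λ ())

infixl 6 _⊕_
_⊕_ : Game → Game → Game
node m f ⊕ node n g =
  node (m + n) (λ k → [ (λ i → f i ⊕ node n g) , (λ j → node m f ⊕ g j) ]′ (splitAt m k))

-- The four outcome types of three-player games.
data Ty : Set where
  𝒩 𝒪 𝒫 𝒬 : Ty

isN isO isP : Ty → Bool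
isN 𝒩 = true
isN _ = false
isO 𝒪 = true
isO _ = false
isP 𝒫 = true
isP _ = false

anyL allL : (Ty → Bool) → List Ty → Bool
anyL p [] = false
anyL p (x ∷ xs) = p x ∨ anyL p xs
allL p [] = true
allL p (x ∷ xs) = p x ∧ allL p xs

nonEmpty : List Ty → Bool
nonEmpty [] = false
nonEmpty (_ ∷ _) = true

classify : List Ty → Ty
classify ts =
  if anyL isP ts then 𝒩
  else if nonEmpty ts ∧ allL isN ts then 𝒪
  else if allL isO ts then 𝒫
  else 𝒬

type : Game → Ty
type (node n f) = classify (tabulate (λ i → type (f i)))

module Submission where

-- The types of G, H and G ⊕ H obey an addition table: each forbidden triple a ⊕ b ↛ c
-- is refuted by induction on G and H, using an option of G or of H whose type is forced
-- by a or b and whose sum with the other game, constrained by the type c of G ⊕ H, would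
-- realise a forbidden triple one level down (only 𝒬 ⊕ 𝒬 ↛ 𝒫 needs to move in both).
--
-- The table gives every claim about G ⊕ G except that doubling an 𝒩-game does not give
-- 𝒩 and doubling an 𝒪-game does not give 𝒪.  If G is 𝒩 and G' ⊕ G is a 𝒫-option of
-- G ⊕ G, the table forces G' to be 𝒪 and its option G' ⊕ G' to be 𝒪.  If G is 𝒪 and
-- G ⊕ G is 𝒪, then for an option G₁ the option G₁ ⊕ G is 𝒩, so it has a 𝒫-option, which
-- the table forces to be X ⊕ G with X an 𝒩-option of G₁; then X ⊕ G₁ is 𝒪 and X ⊕ X is 𝒩.
-- So the 𝒪-claim for G uses the 𝒩-claim two levels down, and the 𝒩-claim for G uses the
-- 𝒪-claim for the options of G.

open import Defs
open import Data.Bool using (Bool; true; false; T; _∧_; if_then_else_)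
open import Data.Bool.Properties using (T-∧; T-∨; T?)
open import Data.Empty using (⊥; ⊥-elim)
open import Data.Fin using (Fin; zero; suc; _↑ˡ_; _↑ʳ_; splitAt)
open import Data.Fin.Properties using (splitAt-↑ˡ; splitAt-↑ʳ)
open import Data.List using (tabulate)
open import Data.Nat using (ℕ)
open import Data.Product using (_×_; _,_; proj₁; proj₂; ∃; ∃-syntax)
import Data.Product as Product
open import Data.Sum using (_⊎_; inj₁; inj₂; [_,_]′)
open import Function using (_∘_; id; Equivalence)
open import Relation.Binary.PropositionalEquality using (_≡_; _≢_; refl; cong)
open import Relation.Nullary using (¬_; yes; no)

open Equivalence using (to; from)

variable
  n : ℕ
  a b c t u s : Ty
  G H G' H' S X : Game

anyL-tabulate : ∀ p (h : Fin n → Ty) → T (anyL p (tabulate h)) → ∃[ i ] T (p (h i))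
anyL-tabulate {ℕ.suc n} p h any =
  [ (λ hd → zero , hd) , Product.map suc id ∘ anyL-tabulate p (h ∘ suc) ]′ (to T-∨ any)

allL-tabulate : ∀ p (h : Fin n → Ty) → T (allL p (tabulate h)) → ∀ i → T (p (h i))
allL-tabulate p h all zero    = proj₁ (to T-∧ all)
allL-tabulate p h all (suc i) = allL-tabulate p (h ∘ suc) (proj₂ (to T-∧ all)) i

¬anyL-tabulate : ∀ p (h : Fin n → Ty) → ¬ T (anyL p (tabulate h)) → ∀ i → ¬ T (p (h i))
¬anyL-tabulate p h ¬any zero    = ¬any ∘ from T-∨ ∘ inj₁
¬anyL-tabulate p h ¬any (suc i) = ¬anyL-tabulate p (h ∘ suc) (¬any ∘ from T-∨ ∘ inj₂) i

¬allL-tabulate : ∀ p (h : Fin n → Ty) → ¬ T (allL p (tabulate h)) → ∃[ i ] ¬ T (p (h i))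
¬allL-tabulate {ℕ.zero} p h ¬all = ⊥-elim (¬all _)
¬allL-tabulate {ℕ.suc n} p h ¬all with T? (p (h zero))
... | no ¬hd = zero , ¬hd
... | yes hd = Product.map suc id (¬allL-tabulate p (h ∘ suc) (λ rest → ¬all (from T-∧ (hd , rest))))

isN-true : T (isN t) → t ≡ 𝒩
isN-true {𝒩} _ = refl

isO-true : T (isO t) → t ≡ 𝒪
isO-true {𝒪} _ = refl

isP-true : T (isP t) → t ≡ 𝒫
isP-true {𝒫} _ = refl

isN-false : ¬ T (isN t) → t ≢ 𝒩
isN-false ¬N refl = ¬N _

isO-false : ¬ T (isO t) → t ≢ 𝒪
isO-false ¬O refl = ¬O _

isP-false : ¬ T (isP t) → t ≢ 𝒫
isP-false ¬P refl = ¬P _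

𝒩⊎𝒬 : t ≢ 𝒪 → t ≢ 𝒫 → t ≡ 𝒩 ⊎ t ≡ 𝒬
𝒩⊎𝒬 {𝒩} _ _ = inj₁ refl
𝒩⊎𝒬 {𝒪} ¬𝒪 _ = ⊥-elim (¬𝒪 refl)
𝒩⊎𝒬 {𝒫} _ ¬𝒫 = ⊥-elim (¬𝒫 refl)
𝒩⊎𝒬 {𝒬} _ _ = inj₂ refl

𝒪⊎𝒬 : t ≢ 𝒩 → t ≢ 𝒫 → t ≡ 𝒪 ⊎ t ≡ 𝒬
𝒪⊎𝒬 {𝒩} ¬𝒩 _ = ⊥-elim (¬𝒩 refl)
𝒪⊎𝒬 {𝒪} _ _ = inj₁ refl
𝒪⊎𝒬 {𝒫} _ ¬𝒫 = ⊥-elim (¬𝒫 refl)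
𝒪⊎𝒬 {𝒬} _ _ = inj₂ refl

𝒫⊎𝒬 : t ≢ 𝒩 → t ≢ 𝒪 → t ≡ 𝒫 ⊎ t ≡ 𝒬
𝒫⊎𝒬 {𝒩} ¬𝒩 _ = ⊥-elim (¬𝒩 refl)
𝒫⊎𝒬 {𝒪} _ ¬𝒪 = ⊥-elim (¬𝒪 refl)
𝒫⊎𝒬 {𝒫} _ _ = inj₁ refl
𝒫⊎𝒬 {𝒬} _ _ = inj₂ refl

ClassifiedAs : Ty → Bool → Bool → Bool → Set
ClassifiedAs 𝒩 someP _    _    = T someP
ClassifiedAs 𝒪 _     allN _    = T allN
ClassifiedAs 𝒫 _     _    allO = T allO
ClassifiedAs 𝒬 someP allN allO = ¬ T someP × ¬ T allN × ¬ T allO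

classify-cases : ∀ p q r →
  ClassifiedAs (if p then 𝒩 else if q then 𝒪 else if r then 𝒫 else 𝒬) p q r
classify-cases true  _     _     = _
classify-cases false true  _     = _
classify-cases false false true  = _
classify-cases false false false = (λ ()) , (λ ()) , (λ ())

type-spec : ∀ (f : Fin n → Game) → type (node n f) ≡ c →
  let ts = tabulate (λ i → type (f i))
  in ClassifiedAs c (anyL isP ts) (nonEmpty ts ∧ allL isN ts) (allL isO ts)
type-spec f refl = classify-cases (anyL isP ts) (nonEmpty ts ∧ allL isN ts) (allL isO ts)
  where ts = tabulate (λ i → type (f i))

infix 4 _◃_
data _◃_ : Game → Game → Set where
  option : ∀ {f : Fin n → Game} (i : Fin n) → f i ◃ node n f

𝒩-option : type G ≡ 𝒩 → ∃[ G' ] G' ◃ G × type G' ≡ 𝒫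
𝒩-option {node n f} e =
  let i , isP = anyL-tabulate isP (type ∘ f) (type-spec f e) in f i , option i , isP-true isP

𝒪-option : type G ≡ 𝒪 → ∃[ G' ] G' ◃ G × type G' ≡ 𝒩
𝒪-option {node ℕ.zero f} e = ⊥-elim (type-spec f e)
𝒪-option {node (ℕ.suc n) f} e =
  f zero , option zero , isN-true (allL-tabulate isN (type ∘ f) (type-spec f e) zero)

𝒪-options : type G ≡ 𝒪 → G' ◃ G → type G' ≡ 𝒩
𝒪-options {node (ℕ.suc n) f} e (option i) = isN-true (allL-tabulate isN (type ∘ f) (type-spec f e) i)

𝒫-options : type G ≡ 𝒫 → G' ◃ G → type G' ≡ 𝒪
𝒫-options {node n f} e (option i) = isO-true (allL-tabulate isO (type ∘ f) (type-spec f e) i)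

𝒬-options : type G ≡ 𝒬 → G' ◃ G → type G' ≢ 𝒫
𝒬-options {node n f} e (option i) = isP-false (¬anyL-tabulate isP (type ∘ f) (proj₁ (type-spec f e)) i)

𝒬-option-𝒩⊎𝒬 : type G ≡ 𝒬 → ∃[ G' ] G' ◃ G × (type G' ≡ 𝒩 ⊎ type G' ≡ 𝒬)
𝒬-option-𝒩⊎𝒬 {node n f} e =
  let i , ¬isO = ¬allL-tabulate isO (type ∘ f) (proj₂ (proj₂ (type-spec f e)))
  in f i , option i , 𝒩⊎𝒬 (isO-false ¬isO) (𝒬-options e (option {f = f} i))

𝒬-option-𝒪⊎𝒬 : type G ≡ 𝒬 → ∃[ G' ] G' ◃ G × (type G' ≡ 𝒪 ⊎ type G' ≡ 𝒬)
𝒬-option-𝒪⊎𝒬 {node ℕ.zero f} e = ⊥-elim (proj₂ (proj₂ (type-spec f e)) _)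
𝒬-option-𝒪⊎𝒬 {node (ℕ.suc n) f} e =
  let i , ¬isN = ¬allL-tabulate isN (type ∘ f) (proj₁ (proj₂ (type-spec f e)))
  in f i , option i , 𝒪⊎𝒬 (isN-false ¬isN) (𝒬-options e (option {f = f} i))

option-at : ∀ {f : Fin n → Game} (k : Fin n) → f k ≡ X → X ◃ node n f
option-at k refl = option k

◃-⊕ˡ : G' ◃ G → G' ⊕ H ◃ G ⊕ H
◃-⊕ˡ {H = node n g} (option {m} i) = option-at (i ↑ˡ n) (cong [ _ , _ ]′ (splitAt-↑ˡ m i n))

◃-⊕ʳ : H' ◃ H → G ⊕ H' ◃ G ⊕ H
◃-⊕ʳ {G = node m f} (option {n} j) = option-at (m ↑ʳ j) (cong [ _ , _ ]′ (splitAt-↑ʳ m n j))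

data SumOption (G H : Game) : Game → Set where
  left  : G' ◃ G → SumOption G H (G' ⊕ H)
  right : H' ◃ H → SumOption G H (G ⊕ H')

◃-⊕⁻ : S ◃ G ⊕ H → SumOption G H S
◃-⊕⁻ {G = node m f} {H = node n g} (option k) with splitAt m k
... | inj₁ i = left (option i)
... | inj₂ j = right (option j)

𝒩-sum : type (G ⊕ H) ≡ 𝒩 →
  (∃[ G' ] G' ◃ G × type (G' ⊕ H) ≡ 𝒫) ⊎ (∃[ H' ] H' ◃ H × type (G ⊕ H') ≡ 𝒫)
𝒩-sum {G} {H} e with 𝒩-option e
... | S , p , eS with ◃-⊕⁻ {G = G} {H} p
... | left q  = inj₁ (_ , q , eS)
... | right q = inj₂ (_ , q , eS)

infix 4 _⊕_↛_
data _⊕_↛_ : Ty → Ty → Ty → Set where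
  𝒩𝒩↛𝒫 : 𝒩 ⊕ 𝒩 ↛ 𝒫
  𝒩𝒫↛𝒫 : 𝒩 ⊕ 𝒫 ↛ 𝒫
  𝒩𝒬↛𝒫 : 𝒩 ⊕ 𝒬 ↛ 𝒫
  𝒪𝒪↛𝒫 : 𝒪 ⊕ 𝒪 ↛ 𝒫
  𝒪𝒫↛𝒫 : 𝒪 ⊕ 𝒫 ↛ 𝒫
  𝒪𝒬↛𝒫 : 𝒪 ⊕ 𝒬 ↛ 𝒫
  𝒫𝒩↛𝒫 : 𝒫 ⊕ 𝒩 ↛ 𝒫
  𝒫𝒪↛𝒫 : 𝒫 ⊕ 𝒪 ↛ 𝒫
  𝒫𝒬↛𝒫 : 𝒫 ⊕ 𝒬 ↛ 𝒫
  𝒬𝒩↛𝒫 : 𝒬 ⊕ 𝒩 ↛ 𝒫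
  𝒬𝒪↛𝒫 : 𝒬 ⊕ 𝒪 ↛ 𝒫
  𝒬𝒫↛𝒫 : 𝒬 ⊕ 𝒫 ↛ 𝒫
  𝒬𝒬↛𝒫 : 𝒬 ⊕ 𝒬 ↛ 𝒫
  𝒩𝒪↛𝒪 : 𝒩 ⊕ 𝒪 ↛ 𝒪
  𝒩𝒫↛𝒪 : 𝒩 ⊕ 𝒫 ↛ 𝒪
  𝒩𝒬↛𝒪 : 𝒩 ⊕ 𝒬 ↛ 𝒪
  𝒪𝒩↛𝒪 : 𝒪 ⊕ 𝒩 ↛ 𝒪
  𝒫𝒩↛𝒪 : 𝒫 ⊕ 𝒩 ↛ 𝒪
  𝒬𝒩↛𝒪 : 𝒬 ⊕ 𝒩 ↛ 𝒪
  𝒫𝒫↛𝒪 : 𝒫 ⊕ 𝒫 ↛ 𝒪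
  𝒫𝒬↛𝒪 : 𝒫 ⊕ 𝒬 ↛ 𝒪
  𝒬𝒫↛𝒪 : 𝒬 ⊕ 𝒫 ↛ 𝒪
  𝒪𝒫↛𝒩 : 𝒪 ⊕ 𝒫 ↛ 𝒩
  𝒫𝒪↛𝒩 : 𝒫 ⊕ 𝒪 ↛ 𝒩
  𝒫𝒫↛𝒩 : 𝒫 ⊕ 𝒫 ↛ 𝒩
  𝒫𝒬↛𝒩 : 𝒫 ⊕ 𝒬 ↛ 𝒩
  𝒬𝒫↛𝒩 : 𝒬 ⊕ 𝒫 ↛ 𝒩
  𝒬𝒬↛𝒩 : 𝒬 ⊕ 𝒬 ↛ 𝒩

𝒫⊕non𝒫↛𝒫 : b ≢ 𝒫 → 𝒫 ⊕ b ↛ 𝒫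
𝒫⊕non𝒫↛𝒫 {𝒩} _ = 𝒫𝒩↛𝒫
𝒫⊕non𝒫↛𝒫 {𝒪} _ = 𝒫𝒪↛𝒫
𝒫⊕non𝒫↛𝒫 {𝒫} ¬𝒫 = ⊥-elim (¬𝒫 refl)
𝒫⊕non𝒫↛𝒫 {𝒬} _ = 𝒫𝒬↛𝒫

non𝒫⊕𝒫↛𝒫 : a ≢ 𝒫 → a ⊕ 𝒫 ↛ 𝒫
non𝒫⊕𝒫↛𝒫 {𝒩} _ = 𝒩𝒫↛𝒫
non𝒫⊕𝒫↛𝒫 {𝒪} _ = 𝒪𝒫↛𝒫
non𝒫⊕𝒫↛𝒫 {𝒫} ¬𝒫 = ⊥-elim (¬𝒫 refl)
non𝒫⊕𝒫↛𝒫 {𝒬} _ = 𝒬𝒫↛𝒫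

any⊕𝒬↛𝒫 : ∀ a → a ⊕ 𝒬 ↛ 𝒫
any⊕𝒬↛𝒫 𝒩 = 𝒩𝒬↛𝒫
any⊕𝒬↛𝒫 𝒪 = 𝒪𝒬↛𝒫
any⊕𝒬↛𝒫 𝒫 = 𝒫𝒬↛𝒫
any⊕𝒬↛𝒫 𝒬 = 𝒬𝒬↛𝒫

𝒬⊕any↛𝒫 : ∀ b → 𝒬 ⊕ b ↛ 𝒫
𝒬⊕any↛𝒫 𝒩 = 𝒬𝒩↛𝒫
𝒬⊕any↛𝒫 𝒪 = 𝒬𝒪↛𝒫
𝒬⊕any↛𝒫 𝒫 = 𝒬𝒫↛𝒫
𝒬⊕any↛𝒫 𝒬 = 𝒬𝒬↛𝒫

ObeysTable : Game → Game → Set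
ObeysTable G H = ∀ {a b c} → a ⊕ b ↛ c → type G ≡ a → type H ≡ b → type (G ⊕ H) ≢ c

module ObeysTableStep {G H : Game}
  (ihˡ : ∀ {G'} → G' ◃ G → ObeysTable G' H)
  (ihʳ : ∀ {H'} → H' ◃ H → ObeysTable G H')
  (ihˡʳ : ∀ {G' H'} → G' ◃ G → H' ◃ H → ObeysTable G' H')
  where

  AllSumOptions : Ty → Set
  AllSumOptions s = ∀ {S} → S ◃ G ⊕ H → type S ≡ s

  viaˡ : ∃[ G' ] G' ◃ G × type G' ≡ t → t ⊕ b ↛ s → type H ≡ b → ¬ AllSumOptions s
  viaˡ (_ , p , e) x eH all = ihˡ p x e eH (all (◃-⊕ˡ p))

  viaʳ : ∃[ H' ] H' ◃ H × type H' ≡ u → a ⊕ u ↛ s → type G ≡ a → ¬ AllSumOptions s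
  viaʳ (_ , q , e) x eG all = ihʳ q x eG e (all (◃-⊕ʳ q))

  no-𝒫-option : type (G ⊕ H) ≡ 𝒩 →
    (∀ {G'} → G' ◃ G → type (G' ⊕ H) ≢ 𝒫) → (∀ {H'} → H' ◃ H → type (G ⊕ H') ≢ 𝒫) → ⊥
  no-𝒫-option eS ¬ˡ ¬ʳ = [ (λ (_ , p , e) → ¬ˡ p e) , (λ (_ , q , e) → ¬ʳ q e) ]′ (𝒩-sum eS)

  refute-𝒫 : a ⊕ b ↛ 𝒫 → type G ≡ a → type H ≡ b → type (G ⊕ H) ≢ 𝒫
  refute-𝒫 𝒩𝒩↛𝒫 eG eH eS = viaˡ (𝒩-option eG) 𝒫𝒩↛𝒪 eH (𝒫-options eS)
  refute-𝒫 𝒩𝒫↛𝒫 eG eH eS = viaˡ (𝒩-option eG) 𝒫𝒫↛𝒪 eH (𝒫-options eS)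
  refute-𝒫 𝒩𝒬↛𝒫 eG eH eS = viaˡ (𝒩-option eG) 𝒫𝒬↛𝒪 eH (𝒫-options eS)
  refute-𝒫 𝒪𝒪↛𝒫 eG eH eS = viaˡ (𝒪-option eG) 𝒩𝒪↛𝒪 eH (𝒫-options eS)
  refute-𝒫 𝒪𝒫↛𝒫 eG eH eS = viaˡ (𝒪-option eG) 𝒩𝒫↛𝒪 eH (𝒫-options eS)
  refute-𝒫 𝒪𝒬↛𝒫 eG eH eS = viaˡ (𝒪-option eG) 𝒩𝒬↛𝒪 eH (𝒫-options eS)
  refute-𝒫 𝒫𝒩↛𝒫 eG eH eS = viaʳ (𝒩-option eH) 𝒫𝒫↛𝒪 eG (𝒫-options eS)
  refute-𝒫 𝒬𝒩↛𝒫 eG eH eS = viaʳ (𝒩-option eH) 𝒬𝒫↛𝒪 eG (𝒫-options eS)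
  refute-𝒫 𝒫𝒪↛𝒫 eG eH eS = viaʳ (𝒪-option eH) 𝒫𝒩↛𝒪 eG (𝒫-options eS)
  refute-𝒫 𝒬𝒪↛𝒫 eG eH eS = viaʳ (𝒪-option eH) 𝒬𝒩↛𝒪 eG (𝒫-options eS)
  refute-𝒫 𝒫𝒬↛𝒫 eG eH eS with 𝒬-option-𝒩⊎𝒬 eH
  ... | H' , q , inj₁ e = viaʳ (H' , q , e) 𝒫𝒩↛𝒪 eG (𝒫-options eS)
  ... | H' , q , inj₂ e = viaʳ (H' , q , e) 𝒫𝒬↛𝒪 eG (𝒫-options eS)
  refute-𝒫 𝒬𝒫↛𝒫 eG eH eS with 𝒬-option-𝒩⊎𝒬 eG
  ... | G' , p , inj₁ e = viaˡ (G' , p , e) 𝒩𝒫↛𝒪 eH (𝒫-options eS)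
  ... | G' , p , inj₂ e = viaˡ (G' , p , e) 𝒬𝒫↛𝒪 eH (𝒫-options eS)
  refute-𝒫 𝒬𝒬↛𝒫 eG eH eS with 𝒬-option-𝒩⊎𝒬 eG | 𝒬-option-𝒩⊎𝒬 eH
  ... | G' , p , inj₁ e | _ = viaˡ (G' , p , e) 𝒩𝒬↛𝒪 eH (𝒫-options eS)
  ... | _ | H' , q , inj₁ e = viaʳ (H' , q , e) 𝒬𝒩↛𝒪 eG (𝒫-options eS)
  ... | G' , p , inj₂ e | H' , q , inj₂ e' =
    ihˡʳ p q 𝒬𝒬↛𝒩 e e' (𝒪-options (𝒫-options eS (◃-⊕ˡ {H = H} p)) (◃-⊕ʳ {G = G'} q))

  refute-𝒪 : a ⊕ b ↛ 𝒪 → type G ≡ a → type H ≡ b → type (G ⊕ H) ≢ 𝒪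
  refute-𝒪 𝒩𝒪↛𝒪 eG eH eS = viaˡ (𝒩-option eG) 𝒫𝒪↛𝒩 eH (𝒪-options eS)
  refute-𝒪 𝒩𝒫↛𝒪 eG eH eS = viaˡ (𝒩-option eG) 𝒫𝒫↛𝒩 eH (𝒪-options eS)
  refute-𝒪 𝒩𝒬↛𝒪 eG eH eS = viaˡ (𝒩-option eG) 𝒫𝒬↛𝒩 eH (𝒪-options eS)
  refute-𝒪 𝒪𝒩↛𝒪 eG eH eS = viaʳ (𝒩-option eH) 𝒪𝒫↛𝒩 eG (𝒪-options eS)
  refute-𝒪 𝒫𝒩↛𝒪 eG eH eS = viaʳ (𝒩-option eH) 𝒫𝒫↛𝒩 eG (𝒪-options eS)
  refute-𝒪 𝒬𝒩↛𝒪 eG eH eS = viaʳ (𝒩-option eH) 𝒬𝒫↛𝒩 eG (𝒪-options eS)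
  refute-𝒪 𝒫𝒫↛𝒪 eG eH eS with 𝒪-option eS
  ... | S , p , _ with ◃-⊕⁻ {G = G} {H} p
  ... | left q  = viaˡ (_ , q , 𝒫-options eG q) 𝒪𝒫↛𝒩 eH (𝒪-options eS)
  ... | right q = viaʳ (_ , q , 𝒫-options eH q) 𝒫𝒪↛𝒩 eG (𝒪-options eS)
  refute-𝒪 𝒫𝒬↛𝒪 eG eH eS with 𝒬-option-𝒪⊎𝒬 eH
  ... | H' , q , inj₁ e = viaʳ (H' , q , e) 𝒫𝒪↛𝒩 eG (𝒪-options eS)
  ... | H' , q , inj₂ e = viaʳ (H' , q , e) 𝒫𝒬↛𝒩 eG (𝒪-options eS)
  refute-𝒪 𝒬𝒫↛𝒪 eG eH eS with 𝒬-option-𝒪⊎𝒬 eG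
  ... | G' , p , inj₁ e = viaˡ (G' , p , e) 𝒪𝒫↛𝒩 eH (𝒪-options eS)
  ... | G' , p , inj₂ e = viaˡ (G' , p , e) 𝒬𝒫↛𝒩 eH (𝒪-options eS)

  refute-𝒩 : a ⊕ b ↛ 𝒩 → type G ≡ a → type H ≡ b → type (G ⊕ H) ≢ 𝒩
  refute-𝒩 𝒪𝒫↛𝒩 eG eH eS = no-𝒫-option eS
    (λ p → ihˡ p 𝒩𝒫↛𝒫 (𝒪-options eG p) eH) (λ q → ihʳ q 𝒪𝒪↛𝒫 eG (𝒫-options eH q))
  refute-𝒩 𝒫𝒪↛𝒩 eG eH eS = no-𝒫-option eS
    (λ p → ihˡ p 𝒪𝒪↛𝒫 (𝒫-options eG p) eH) (λ q → ihʳ q 𝒫𝒩↛𝒫 eG (𝒪-options eH q))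
  refute-𝒩 𝒫𝒫↛𝒩 eG eH eS = no-𝒫-option eS
    (λ p → ihˡ p 𝒪𝒫↛𝒫 (𝒫-options eG p) eH) (λ q → ihʳ q 𝒫𝒪↛𝒫 eG (𝒫-options eH q))
  refute-𝒩 𝒫𝒬↛𝒩 eG eH eS = no-𝒫-option eS
    (λ p → ihˡ p 𝒪𝒬↛𝒫 (𝒫-options eG p) eH)
    (λ q → ihʳ q (𝒫⊕non𝒫↛𝒫 (𝒬-options eH q)) eG refl)
  refute-𝒩 𝒬𝒫↛𝒩 eG eH eS = no-𝒫-option eS
    (λ p → ihˡ p (non𝒫⊕𝒫↛𝒫 (𝒬-options eG p)) refl eH)
    (λ q → ihʳ q 𝒬𝒪↛𝒫 eG (𝒫-options eH q))
  refute-𝒩 𝒬𝒬↛𝒩 eG eH eS = no-𝒫-option eS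
    (λ {G'} p → ihˡ p (any⊕𝒬↛𝒫 (type G')) refl eH)
    (λ {H'} q → ihʳ q (𝒬⊕any↛𝒫 (type H')) eG refl)

  obeysTable : ObeysTable G H
  obeysTable {c = 𝒩} = refute-𝒩
  obeysTable {c = 𝒪} = refute-𝒪
  obeysTable {c = 𝒫} = refute-𝒫
  obeysTable {c = 𝒬} ()

mutual
  ⊕-obeysTable : ∀ G H → ObeysTable G H
  ⊕-obeysTable G H =
    ObeysTableStep.obeysTable (obeysTableˡ G H) (obeysTableʳ G H) (obeysTableˡʳ G H)

  obeysTableˡ : ∀ G H → G' ◃ G → ObeysTable G' H
  obeysTableˡ (node m f) H (option i) = ⊕-obeysTable (f i) H

  obeysTableʳ : ∀ G H → H' ◃ H → ObeysTable G H'
  obeysTableʳ G (node n g) (option j) = ⊕-obeysTable G (g j)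

  obeysTableˡʳ : ∀ G H → G' ◃ G → H' ◃ H → ObeysTable G' H'
  obeysTableˡʳ (node m f) (node n g) (option i) (option j) = ⊕-obeysTable (f i) (g j)

𝒫-sum-𝒩ʳ⇒𝒪ˡ : type H ≡ 𝒩 → type (G ⊕ H) ≡ 𝒫 → type G ≡ 𝒪
𝒫-sum-𝒩ʳ⇒𝒪ˡ {H} {G} eH eS with type G in eG
... | 𝒩 = ⊥-elim (⊕-obeysTable G H 𝒩𝒩↛𝒫 eG eH eS)
... | 𝒪 = refl
... | 𝒫 = ⊥-elim (⊕-obeysTable G H 𝒫𝒩↛𝒫 eG eH eS)
... | 𝒬 = ⊥-elim (⊕-obeysTable G H 𝒬𝒩↛𝒫 eG eH eS)

𝒫-sum-𝒩ˡ⇒𝒪ʳ : type G ≡ 𝒩 → type (G ⊕ H) ≡ 𝒫 → type H ≡ 𝒪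
𝒫-sum-𝒩ˡ⇒𝒪ʳ {G} {H} eG eS with type H in eH
... | 𝒩 = ⊥-elim (⊕-obeysTable G H 𝒩𝒩↛𝒫 eG eH eS)
... | 𝒪 = refl
... | 𝒫 = ⊥-elim (⊕-obeysTable G H 𝒩𝒫↛𝒫 eG eH eS)
... | 𝒬 = ⊥-elim (⊕-obeysTable G H 𝒩𝒬↛𝒫 eG eH eS)

𝒫-sum-𝒪ʳ⇒𝒩ˡ : type H ≡ 𝒪 → type (G ⊕ H) ≡ 𝒫 → type G ≡ 𝒩
𝒫-sum-𝒪ʳ⇒𝒩ˡ {H} {G} eH eS with type G in eG
... | 𝒩 = refl
... | 𝒪 = ⊥-elim (⊕-obeysTable G H 𝒪𝒪↛𝒫 eG eH eS)
... | 𝒫 = ⊥-elim (⊕-obeysTable G H 𝒫𝒪↛𝒫 eG eH eS)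
... | 𝒬 = ⊥-elim (⊕-obeysTable G H 𝒬𝒪↛𝒫 eG eH eS)

selfSum-𝒩≢𝒩-step : (∀ {G'} → G' ◃ G → type G' ≡ 𝒪 → type (G' ⊕ G') ≢ 𝒪) →
                    type G ≡ 𝒩 → type (G ⊕ G) ≢ 𝒩
selfSum-𝒩≢𝒩-step {G} ih eG eGG with 𝒩-sum {G} {G} eGG
... | inj₁ (G' , p , eS) =
  ih p (𝒫-sum-𝒩ʳ⇒𝒪ˡ {H = G} {G = G'} eG eS) (𝒫-options eS (◃-⊕ʳ {G = G'} p))
... | inj₂ (G' , p , eS) =
  ih p (𝒫-sum-𝒩ˡ⇒𝒪ʳ {G = G} {H = G'} eG eS) (𝒫-options eS (◃-⊕ˡ {H = G'} p))

selfSum-𝒪≢𝒪-step : (∀ {G₁ X} → G₁ ◃ G → X ◃ G₁ → type X ≡ 𝒩 → type (X ⊕ X) ≢ 𝒩) →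
                    type G ≡ 𝒪 → type (G ⊕ G) ≢ 𝒪
selfSum-𝒪≢𝒪-step {G} ih eG eGG with 𝒪-option eG
... | G₁ , p , eG₁ with 𝒩-sum {G₁} {G} (𝒪-options eGG (◃-⊕ˡ {H = G} p))
... | inj₁ (X , x , eS) =
  let X⊕G₁-is-𝒪 = 𝒫-options eS (◃-⊕ʳ {G = X} p)
  in ih p x (𝒫-sum-𝒪ʳ⇒𝒩ˡ {H = G} {G = X} eG eS) (𝒪-options X⊕G₁-is-𝒪 (◃-⊕ʳ {G = X} x))
... | inj₂ (G₂ , q , eS) = ⊕-obeysTable G₁ G₂ 𝒩𝒩↛𝒫 eG₁ (𝒪-options eG q) eS

mutual
  selfSum-𝒩≢𝒩 : ∀ G → type G ≡ 𝒩 → type (G ⊕ G) ≢ 𝒩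
  selfSum-𝒩≢𝒩 G = selfSum-𝒩≢𝒩-step (selfSum-𝒪≢𝒪-onOptions G)

  selfSum-𝒪≢𝒪 : ∀ G → type G ≡ 𝒪 → type (G ⊕ G) ≢ 𝒪
  selfSum-𝒪≢𝒪 G = selfSum-𝒪≢𝒪-step (selfSum-𝒩≢𝒩-onOptions² G)

  selfSum-𝒪≢𝒪-onOptions : ∀ G → G' ◃ G → type G' ≡ 𝒪 → type (G' ⊕ G') ≢ 𝒪
  selfSum-𝒪≢𝒪-onOptions (node n f) (option i) = selfSum-𝒪≢𝒪 (f i)

  selfSum-𝒩≢𝒩-onOptions : ∀ G → X ◃ G → type X ≡ 𝒩 → type (X ⊕ X) ≢ 𝒩
  selfSum-𝒩≢𝒩-onOptions (node n f) (option i) = selfSum-𝒩≢𝒩 (f i)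

  selfSum-𝒩≢𝒩-onOptions² : ∀ G → G' ◃ G → X ◃ G' → type X ≡ 𝒩 → type (X ⊕ X) ≢ 𝒩
  selfSum-𝒩≢𝒩-onOptions² (node n f) (option i) = selfSum-𝒩≢𝒩-onOptions (f i)

⟨_⟩ : Game → Game
⟨ G ⟩ = node 1 (λ _ → G)

⟨_∣_⟩ : Game → Game → Game
⟨ G ∣ H ⟩ = node 2 λ { zero → G ; (suc _) → H }

*1 *2 : Game
*1 = ⟨ zeroGame ⟩
*2 = ⟨ zeroGame ∣ *1 ⟩

mainTheorem9 :
    (∀ (G : Game) →
        (type G ≡ 𝒫 → type (G ⊕ G) ≡ 𝒫 ⊎ type (G ⊕ G) ≡ 𝒬)
      × (type G ≡ 𝒩 → type (G ⊕ G) ≡ 𝒪 ⊎ type (G ⊕ G) ≡ 𝒬)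
      × (type G ≡ 𝒪 → type (G ⊕ G) ≡ 𝒩 ⊎ type (G ⊕ G) ≡ 𝒬)
      × (type G ≡ 𝒬 → type (G ⊕ G) ≡ 𝒪 ⊎ type (G ⊕ G) ≡ 𝒬))
    × (∃ λ G → type G ≡ 𝒫 × type (G ⊕ G) ≡ 𝒫)
    × (∃ λ G → type G ≡ 𝒫 × type (G ⊕ G) ≡ 𝒬)
    × (∃ λ G → type G ≡ 𝒩 × type (G ⊕ G) ≡ 𝒪)
    × (∃ λ G → type G ≡ 𝒩 × type (G ⊕ G) ≡ 𝒬)
    × (∃ λ G → type G ≡ 𝒪 × type (G ⊕ G) ≡ 𝒩)
    × (∃ λ G → type G ≡ 𝒪 × type (G ⊕ G) ≡ 𝒬)
    × (∃ λ G → type G ≡ 𝒬 × type (G ⊕ G) ≡ 𝒪)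
    × (∃ λ G → type G ≡ 𝒬 × type (G ⊕ G) ≡ 𝒬)
mainTheorem9 =
  (λ G → (λ e → 𝒫⊎𝒬 (⊕-obeysTable G G 𝒫𝒫↛𝒩 e e) (⊕-obeysTable G G 𝒫𝒫↛𝒪 e e))
       , (λ e → 𝒪⊎𝒬 (selfSum-𝒩≢𝒩 G e) (⊕-obeysTable G G 𝒩𝒩↛𝒫 e e))
       , (λ e → 𝒩⊎𝒬 (selfSum-𝒪≢𝒪 G e) (⊕-obeysTable G G 𝒪𝒪↛𝒫 e e))
       , (λ e → 𝒪⊎𝒬 (⊕-obeysTable G G 𝒬𝒬↛𝒩 e e) (⊕-obeysTable G G 𝒬𝒬↛𝒫 e e)))
  , (zeroGame , refl , refl)
  , (⟨ ⟨ *2 ⟩ ⟩ , refl , refl)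
  , (*1 , refl , refl)
  , (*2 , refl , refl)
  , (⟨ *1 ⟩ , refl , refl)
  , (⟨ *2 ⟩ , refl , refl)
  , (⟨ ⟨ *1 ⟩ ∣ *1 ⟩ , refl , refl)
  , (⟨ ⟨ ⟨ *1 ⟩ ∣ *1 ⟩ ⟩ , refl , refl)
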